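{- Let $B = \{b_1 < b_2 < \dots\}$ be an infinite arithmetic progression of integers with common difference $d$ (so $b_n = b_1 + (n-1)d$), where $b_1 \in \{4, 7, 8\} \cup \{b \in \mathbb{N} : b \geq 11\}$. If $b_1 + 2 \leq d \leq 2b_1 + 1$, then there exists a sequence of positive integers $A = \{a_1 < a_2 < \dots\}$ such that $P(A) = \mathbb{N} \setminus B$.
   Context: $\mathbb{N}$ denotes the set of all nonnegative integers. For a set $A = \{a_1 < a_2 < \dots\}$ of positive integers, $P(A) = \{\sum \varepsilon_i a_i : a_i \in A, \varepsilon_i \in \{0,1\}, \sum \varepsilon_i < \infty\}$ is the set of all finite subset sums of $A$; in particular $0 \in P(A)$ (empty sum). -}

module Defs where

open import Data.Nat using (ℕ; _+_; _*_; _<_)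
open import Data.List using (List; map)
open import Data.Nat.ListAction using (sum)
open import Data.List.Relation.Unary.Unique.Propositional using (Unique)
open import Data.Product using (Σ; _×_; ∃)
open import Relation.Binary.PropositionalEquality using (_≡_)

-- A sequence a : ℕ → ℕ (a 0 = a₁, a 1 = a₂, ...) is strictly increasing.
StrictlyIncreasing : (ℕ → ℕ) → Set
StrictlyIncreasing a = ∀ i → a i < a (i + 1)

-- n ∈ P(A), A = {a 0 < a 1 < ...}: n is the sum of a_i over a finite set of
-- distinct indices i (the empty set gives 0).
InP : (ℕ → ℕ) → ℕ → Set
InP a n = Σ (List ℕ) λ is → Unique is × sum (map a is) ≡ n

InB : ℕ → ℕ → ℕ → Set
InB b₁ d n = ∃ λ k → n ≡ b₁ + k * d

{-# OPTIONS --safe #-}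
-- Write b₁ = s + 1. Call an increasing sequence c₀ < ⋯ < c_{k-1} of positive integers complete
-- if cᵢ ≤ 1 + c₀ + ⋯ + c_{i-1} for all i; its subset sums are then exactly 0, 1, …, c₀ + ⋯ + c_{k-1}.
-- For admissible b₁ there is a complete sequence with total s (1, 2, …, j, x with
-- j < x ≤ 1 + (1 + ⋯ + j), or 1, 2, 4, 7 when s = 14). Continue it with b₁ + 1, d, 2d, 3d, …;
-- the subset sums of the continuation are y and b₁ + 1 + y for d ∣ y, so
-- P(A) = {r + y, r + b₁ + 1 + y : 0 ≤ r ≤ s, d ∣ y}. As b₁ + 2 ≤ d ≤ 2b₁ + 1, this meets every
-- residue class modulo d except that of b₁, and b₁ + Kd is never attained: r + y would force r = b₁,
-- and r + b₁ + 1 + y would force d ∣ r + 1 although 0 < r + 1 < d.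
module Submission where

open import Defs
open import Data.Nat using (ℕ; zero; suc; _+_; _*_; _∸_; _<_; _≤_; z≤n; s≤s; z<s; _<?_; _≤?_; NonZero; >-nonZero)
open import Data.Nat.Properties
open import Data.Nat.Divisibility using (_∣_; divides; _∣0; n∣m*n; ∣m∣n⇒∣m+n; ∣m+n∣m⇒∣n; ∣⇒≤)
open import Data.Nat.DivMod using (_%_; _/_; m≡m%n+[m/n]*n; m%n<n; [m+kn]%n≡m%n; %-remove-+ʳ; m<n⇒m%n≡m)
open import Data.Nat.ListAction using (sum)
open import Data.Nat.Tactic.RingSolver using (solve-∀)
open import Data.Nat.ListAction.Properties using (sum-++)
open import Data.List using (List; []; _∷_; _++_; map; filter)
open import Data.List.Properties using (map-++; map-∘; map-cong; map-cong-local; map-id-local)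
open import Data.List.Membership.Propositional using (_∈_)
open import Data.List.Membership.Propositional.Properties using (∈-map⁻)
open import Data.List.Relation.Unary.All using (All; []; _∷_)
import Data.List.Relation.Unary.All as All
open import Data.List.Relation.Unary.All.Properties using (all-filter) renaming (filter⁺ to All-filter⁺)
open import Data.List.Relation.Unary.Unique.Propositional using (Unique; []; _∷_)
import Data.List.Relation.Unary.Unique.Propositional.Properties as Unique
open import Data.Product using (Σ; _×_; _,_; ∃; ∃₂)
open import Data.Sum using (_⊎_; inj₁; inj₂)
import Data.Sum as Sum
open import Data.Empty using (⊥-elim)
open import Function using (_∘_)
open import Function.Bundles using (_⇔_; mk⇔)
open import Relation.Nullary using (¬_; Dec; yes; no)
open import Relation.Nullary.Decidable using (from-yes)
open import Relation.Unary using (Pred; Decidable)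
open import Relation.Unary.Properties using (∁?)
open import Relation.Binary.PropositionalEquality
open import Level using (0ℓ)
open import Algebra.Properties.CommutativeSemigroup +-commutativeSemigroup using (x∙yz≈y∙xz)

sum-map-filter : {A : Set} {P : Pred A 0ℓ} (P? : Decidable P) (f : A → ℕ) (xs : List A) →
  sum (map f xs) ≡ sum (map f (filter P? xs)) + sum (map f (filter (∁? P?) xs))
sum-map-filter P? f [] = refl
sum-map-filter P? f (x ∷ xs) with P? x
... | yes _ = trans (cong (f x +_) (sum-map-filter P? f xs)) (sym (+-assoc (f x) _ _))
... | no _ = trans (cong (f x +_) (sum-map-filter P? f xs))
  (x∙yz≈y∙xz (f x) (sum (map f (filter P? xs))) (sum (map f (filter (∁? P?) xs))))

partialSum : (ℕ → ℕ) → ℕ → ℕ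
partialSum c zero = 0
partialSum c (suc k) = partialSum c k + c k

InPFirst : ℕ → (ℕ → ℕ) → ℕ → Set
InPFirst k c r = Σ (List ℕ) λ is → Unique is × All (_< k) is × sum (map c is) ≡ r

Unique∧All≡⇒sum≤ : ∀ (c : ℕ → ℕ) {k is} → Unique is → All (_≡ k) is → sum (map c is) ≤ c k
Unique∧All≡⇒sum≤ c [] [] = z≤n
Unique∧All≡⇒sum≤ c (_ ∷ []) (refl ∷ []) = ≤-reflexive (+-identityʳ _)
Unique∧All≡⇒sum≤ c ((i≢j ∷ _) ∷ _) (refl ∷ refl ∷ _) = ⊥-elim (i≢j refl)

InPFirst⇒≤partialSum : ∀ {c} k {r} → InPFirst k c r → r ≤ partialSum c k
InPFirst⇒≤partialSum zero ([] , _ , [] , refl) = z≤n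
InPFirst⇒≤partialSum {c} (suc k) (is , u , is<1+k , refl) = begin
  sum (map c is)                       ≡⟨ sum-map-filter (_<? k) c is ⟩
  sum (map c lows) + sum (map c rest)  ≤⟨ +-mono-≤ lows-bound rest-bound ⟩
  partialSum c k + c k                 ∎
  where
  open ≤-Reasoning
  lows rest : List ℕ
  lows = filter (_<? k) is
  rest = filter (∁? (_<? k)) is
  lows-bound : sum (map c lows) ≤ partialSum c k
  lows-bound = InPFirst⇒≤partialSum k (lows , Unique.filter⁺ _ u , all-filter _ is , refl)
  rest≡k : All (_≡ k) rest
  rest≡k = All.zipWith (λ (i<1+k , i≮k) → ≤∧≮⇒≡ (<⇒≤pred i<1+k) i≮k)
             (All-filter⁺ _ is<1+k , all-filter _ is)
  rest-bound : sum (map c rest) ≤ c k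
  rest-bound = Unique∧All≡⇒sum≤ c (Unique.filter⁺ _ u) rest≡k

InPFirst-suc : ∀ {k c r} → InPFirst k c r → InPFirst (suc k) c r
InPFirst-suc (is , u , is<k , e) = is , u , All.map m<n⇒m<1+n is<k , e

InPFirst-add : ∀ {k c r} → InPFirst k c r → InPFirst (suc k) c (c k + r)
InPFirst-add {k} {c} (is , u , is<k , e) =
  k ∷ is , All.map >⇒≢ is<k ∷ u , n<1+n k ∷ All.map m<n⇒m<1+n is<k , cong (c k +_) e

InPFirst-one⁻ : ∀ {c r} → InPFirst 1 c r → r ≡ 0 ⊎ r ≡ c 0
InPFirst-one⁻ ([] , _ , _ , refl) = inj₁ refl
InPFirst-one⁻ (0 ∷ [] , _ , _ , refl) = inj₂ (+-identityʳ _)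
InPFirst-one⁻ (0 ∷ 0 ∷ _ , (0≢0 ∷ _) ∷ _ , _ , _) = ⊥-elim (0≢0 refl)
InPFirst-one⁻ (0 ∷ suc _ ∷ _ , _ , _ ∷ s≤s () ∷ _ , _)
InPFirst-one⁻ (suc _ ∷ _ , _ , s≤s () ∷ _ , _)

Complete : ℕ → (ℕ → ℕ) → Set
Complete k c = ∀ i → i < k → c i ≤ suc (partialSum c i)

Complete⇒InPFirst : ∀ {c} k → Complete k c → ∀ {r} → r ≤ partialSum c k → InPFirst k c r
Complete⇒InPFirst zero _ r≤0 = [] , [] , [] , sym (n≤0⇒n≡0 r≤0)
Complete⇒InPFirst {c} (suc k) complete {r} r≤ = split (r ≤? partialSum c k)
  where
  complete′ : Complete k c
  complete′ i i<k = complete i (m<n⇒m<1+n i<k)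
  split : Dec (r ≤ partialSum c k) → InPFirst (suc k) c r
  split (yes r≤S) = InPFirst-suc (Complete⇒InPFirst k complete′ r≤S)
  split (no r≰S) = subst (InPFirst (suc k) c) (m+[n∸m]≡n ck≤r)
                     (InPFirst-add (Complete⇒InPFirst k complete′ rest≤S))
    where
    ck≤r : c k ≤ r
    ck≤r = ≤-trans (complete k (n<1+n k)) (≰⇒> r≰S)
    rest≤S : r ∸ c k ≤ partialSum c k
    rest≤S = ≤-trans (∸-monoˡ-≤ (c k) r≤) (≤-reflexive (m+n∸n≡m (partialSum c k) (c k)))

prepend : ℕ → (ℕ → ℕ) → (ℕ → ℕ) → ℕ → ℕ
prepend k c t i with i <? k
... | yes _ = c i
... | no _ = t (i ∸ k)

prepend-< : ∀ {k c t i} → i < k → prepend k c t i ≡ c i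
prepend-< {k} {i = i} i<k with i <? k
... | yes _ = refl
... | no i≮k = ⊥-elim (i≮k i<k)

prepend-≮ : ∀ {k c t i} → ¬ i < k → prepend k c t i ≡ t (i ∸ k)
prepend-≮ {k} {i = i} i≮k with i <? k
... | yes i<k = ⊥-elim (i≮k i<k)
... | no _ = refl

prepend-+ : ∀ k c t j → prepend k c t (k + j) ≡ t j
prepend-+ k c t j = trans (prepend-≮ (m+n≮m k j)) (cong t (m+n∸m≡n k j))

partialSum-prepend : ∀ {k c t i} → i ≤ k → partialSum (prepend k c t) i ≡ partialSum c i
partialSum-prepend {i = zero} _ = refl
partialSum-prepend {i = suc i} i<k = cong₂ _+_ (partialSum-prepend (<⇒≤ i<k)) (prepend-< i<k)

prepend-increasing : ∀ {k c t} →
  (∀ i → suc i < k → c i < c (suc i)) → (∀ i → i < k → c i < t 0) → (∀ j → t j < t (suc j)) →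
  ∀ i → prepend k c t i < prepend k c t (suc i)
prepend-increasing {k} {c} {t} c↑ c<t t↑ i with suc i <? k | i <? k
... | yes 1+i<k | yes _ = c↑ i 1+i<k
... | yes 1+i<k | no i≮k = ⊥-elim (i≮k (<-trans (n<1+n i) 1+i<k))
... | no _ | yes i<k = subst (λ j → c i < t j) (sym (m≤n⇒m∸n≡0 i<k)) (c<t i i<k)
... | no _ | no i≮k = subst (λ j → t (i ∸ k) < t j) (sym (+-∸-assoc 1 (≮⇒≥ i≮k))) (t↑ (i ∸ k))

prepend-positive : ∀ {k c t} → (∀ i → i < k → 0 < c i) → (∀ j → 0 < t j) → ∀ i → 0 < prepend k c t i
prepend-positive {k} c>0 t>0 i with i <? k
... | yes i<k = c>0 i i<k
... | no _ = t>0 _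

InP-prepend⁺ : ∀ {k c t r₁ r₂} → InPFirst k c r₁ → InP t r₂ → InP (prepend k c t) (r₁ + r₂)
InP-prepend⁺ {k} {c} {t} (is , u , is<k , refl) (js , v , refl) =
  is ++ map (k +_) js , Unique.++⁺ u (Unique.map⁺ (+-cancelˡ-≡ k _ _) v) disjoint , sum≡
  where
  open ≡-Reasoning
  a : ℕ → ℕ
  a = prepend k c t
  disjoint : ∀ {v} → ¬ (v ∈ is × v ∈ map (k +_) js)
  disjoint (v∈is , v∈js) with ∈-map⁻ (k +_) v∈js
  ... | j , _ , refl = m+n≮m k j (All.lookup is<k v∈is)
  sum≡ : sum (map a (is ++ map (k +_) js)) ≡ sum (map c is) + sum (map t js)
  sum≡ = begin
    sum (map a (is ++ map (k +_) js))          ≡⟨ cong sum (map-++ a is _) ⟩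
    sum (map a is ++ map a (map (k +_) js))    ≡⟨ sum-++ (map a is) _ ⟩
    sum (map a is) + sum (map a (map (k +_) js))
      ≡⟨ cong₂ _+_ (cong sum (map-cong-local (All.map prepend-< is<k)))
                   (cong sum (trans (sym (map-∘ js)) (map-cong (prepend-+ k c t) js))) ⟩
    sum (map c is) + sum (map t js)            ∎

InP-prepend⁻ : ∀ {k c t n} → InP (prepend k c t) n →
  ∃₂ λ r₁ r₂ → InPFirst k c r₁ × InP t r₂ × n ≡ r₁ + r₂
InP-prepend⁻ {k} {c} {t} (is , u , refl) =
  _ , _ , (lows , Unique.filter⁺ _ u , all-filter _ is , refl) , (highs , highs-unique , refl) , sum≡
  where
  open ≡-Reasoning
  a : ℕ → ℕ
  a = prepend k c t
  lows rest highs : List ℕ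
  lows = filter (_<? k) is
  rest = filter (∁? (_<? k)) is
  highs = map (_∸ k) rest
  highs-unique : Unique highs
  highs-unique = Unique.map⁻ (subst Unique (sym restore) (Unique.filter⁺ _ u))
    where
    restore : map (k +_) highs ≡ rest
    restore = trans (sym (map-∘ rest)) (map-id-local (All.map (m+[n∸m]≡n ∘ ≮⇒≥) (all-filter _ is)))
  sum≡ : sum (map a is) ≡ sum (map c lows) + sum (map t highs)
  sum≡ = begin
    sum (map a is)                        ≡⟨ sum-map-filter (_<? k) a is ⟩
    sum (map a lows) + sum (map a rest)
      ≡⟨ cong₂ _+_ (cong sum (map-cong-local (All.map prepend-< (all-filter _ is))))
                   (cong sum (trans (map-cong-local (All.map prepend-≮ (all-filter _ is))) (map-∘ rest))) ⟩
    sum (map c lows) + sum (map t highs)  ∎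

multiples : ℕ → ℕ → ℕ
multiples d j = suc j * d

InP-multiples⁻ : ∀ {d y} → InP (multiples d) y → d ∣ y
InP-multiples⁻ {d} (js , _ , refl) = sum-divisible js
  where
  sum-divisible : ∀ js → d ∣ sum (map (multiples d) js)
  sum-divisible [] = d ∣0
  sum-divisible (j ∷ js) = ∣m∣n⇒∣m+n (n∣m*n (suc j)) (sum-divisible js)

InP-multiples⁺ : ∀ {d y} → d ∣ y → InP (multiples d) y
InP-multiples⁺ (divides zero refl) = [] , [] , refl
InP-multiples⁺ (divides (suc q) refl) = q ∷ [] , [] ∷ [] , +-identityʳ _

record CompleteSequence (s ℓ : ℕ) : Set where
  field
    size : ℕ
    term : ℕ → ℕ
    increasing : ∀ i → suc i < size → term i < term (suc i)
    positive : ∀ i → i < size → 0 < term i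
    bounded : ∀ i → i < size → term i ≤ ℓ
    complete : Complete size term
    total : partialSum term size ≡ s

  term≤total : ∀ i → i < size → term i ≤ s
  term≤total i i<size = subst (term i ≤_) total
    (≤-trans (m≤m+n (term i) 0) (InPFirst⇒≤partialSum size (i ∷ [] , [] ∷ [] , i<size ∷ [] , refl)))

empty : CompleteSequence 0 0
empty = record
  { size = 0 ; term = λ _ → 0 ; increasing = λ _ () ; positive = λ _ ()
  ; bounded = λ _ () ; complete = λ _ () ; total = refl }

extend : ∀ {s ℓ x} → CompleteSequence s ℓ → ℓ < x → x ≤ suc s → CompleteSequence (s + x) x
extend {s} {ℓ} {x} C ℓ<x x≤1+s = record
  { size = suc size ; term = term′ ; increasing = increasing′ ; positive = positive′
  ; bounded = bounded′ ; complete = complete′ ; total = total′ }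
  where
  open CompleteSequence C
  term′ : ℕ → ℕ
  term′ = prepend size term (λ _ → x)
  partialSum′ : ∀ {i} → i ≤ size → partialSum term′ i ≡ partialSum term i
  partialSum′ = partialSum-prepend
  increasing′ : ∀ i → suc i < suc size → term′ i < term′ (suc i)
  increasing′ i (s≤s 1+i≤size) with suc i <? size | i <? size
  ... | yes 1+i<size | yes _ = increasing i 1+i<size
  ... | yes 1+i<size | no i≮size = ⊥-elim (i≮size (<-trans (n<1+n i) 1+i<size))
  ... | no _ | yes i<size = ≤-<-trans (bounded i i<size) ℓ<x
  ... | no _ | no i≮size = ⊥-elim (i≮size 1+i≤size)
  positive′ : ∀ i → i < suc size → 0 < term′ i
  positive′ i _ = prepend-positive {size} {term} positive (λ _ → ≤-<-trans z≤n ℓ<x) i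
  bounded′ : ∀ i → i < suc size → term′ i ≤ x
  bounded′ i _ with i <? size
  ... | yes i<size = ≤-trans (bounded i i<size) (<⇒≤ ℓ<x)
  ... | no _ = ≤-refl
  complete′ : Complete (suc size) term′
  complete′ i (s≤s i≤size) with i <? size
  ... | yes i<size = subst (λ σ → term i ≤ suc σ) (sym (partialSum′ (<⇒≤ i<size))) (complete i i<size)
  ... | no i≮size with ≤∧≮⇒≡ i≤size i≮size
  ...   | refl = subst (λ σ → x ≤ suc σ) (sym (trans (partialSum′ ≤-refl) total)) x≤1+s
  total′ : partialSum term′ (suc size) ≡ s + x
  total′ = cong₂ _+_ (trans (partialSum′ ≤-refl) total) (prepend-≮ (n≮n size))

triangle : ℕ → ℕ
triangle = partialSum suc

n≤triangle : ∀ n → n ≤ triangle n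
n≤triangle zero = z≤n
n≤triangle (suc n) = m≤n+m (suc n) (triangle n)

staircase : ∀ j → CompleteSequence (triangle j) j
staircase zero = empty
staircase (suc j) = extend (staircase j) (n<1+n j) (s≤s (n≤triangle j))

triangle-room : ∀ n → n + n < triangle n → suc n + suc n < triangle (suc n)
triangle-room zero ()
triangle-room n@(suc _) room = begin
  suc (suc n + suc n)      ≡⟨ cong (suc ∘ suc) (+-suc n n) ⟩
  2 + suc (n + n)          ≡⟨ +-comm 2 (suc (n + n)) ⟩
  suc (n + n) + 2          ≤⟨ +-mono-≤ room (s≤s (s≤s z≤n)) ⟩
  triangle n + suc n       ∎
  where open ≤-Reasoning

-- s = 1 + ⋯ + j + x; the first condition leaves room to pass from x = 1 + (1 + ⋯ + j) to j + 1.
StaircaseSum : ℕ → Set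
StaircaseSum s = ∃₂ λ j x → j + j < triangle j × j < x × x ≤ suc (triangle j) × triangle j + x ≡ s

staircaseSum-suc : ∀ {s} → StaircaseSum s → StaircaseSum (suc s)
staircaseSum-suc (j , x , room , j<x , x≤1+T , refl) with x ≤? triangle j
... | yes x≤T = j , suc x , room , m<n⇒m<1+n j<x , s≤s x≤T , +-suc (triangle j) x
... | no x≰T with ≤-antisym x≤1+T (≰⇒> x≰T)
...   | refl = suc j , suc T ∸ j , triangle-room j room ,
               m+n≤o⇒m≤o∸n (suc (suc j)) (s≤s room) ,
               ≤-trans (m∸n≤m (suc T) j) (s≤s (m≤m+n T (suc j))) , sum≡
  where
  open ≡-Reasoning
  T : ℕ
  T = triangle j
  sum≡ : T + suc j + (suc T ∸ j) ≡ suc (T + suc T)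
  sum≡ = begin
    T + suc j + (suc T ∸ j)    ≡⟨ +-assoc T (suc j) _ ⟩
    T + suc (j + (suc T ∸ j))  ≡⟨ cong (λ y → T + suc y) (m+[n∸m]≡n (≤-trans (n≤triangle j) (n≤1+n T))) ⟩
    T + suc (suc T)            ≡⟨ +-suc T (suc T) ⟩
    suc (T + suc T)            ∎

staircaseSum-15+ : ∀ m → StaircaseSum (15 + m)
staircaseSum-15+ zero = 4 , 5 , from-yes (8 <? 10) , from-yes (4 <? 5) , from-yes (5 ≤? 11) , refl
staircaseSum-15+ (suc m) = staircaseSum-suc (staircaseSum-15+ m)

staircaseSum⇒complete : ∀ {s} → StaircaseSum s → ∃ (CompleteSequence s)
staircaseSum⇒complete (j , x , _ , j<x , x≤1+T , refl) = x , extend (staircase j) j<x x≤1+T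

completeSequence : ∀ {b₁} → b₁ ≡ 4 ⊎ b₁ ≡ 7 ⊎ b₁ ≡ 8 ⊎ 11 ≤ b₁ →
  Σ ℕ λ s → b₁ ≡ suc s × ∃ (CompleteSequence s)
completeSequence (inj₁ refl) = 3 , refl , 2 , staircase 2
completeSequence (inj₂ (inj₁ refl)) = 6 , refl , 3 , staircase 3
completeSequence (inj₂ (inj₂ (inj₁ refl))) =
  7 , refl , 4 , extend (staircase 2) (from-yes (2 <? 4)) (from-yes (4 ≤? 4))
completeSequence (inj₂ (inj₂ (inj₂ 11≤b₁))) with m≤n⇒∃[o]m+o≡n 11≤b₁
... | m , refl = 10 + m , refl , from10 m
  where
  from10 : ∀ m → ∃ (CompleteSequence (10 + m))
  from10 0 = 4 , extend (staircase 3) (from-yes (3 <? 4)) (from-yes (4 ≤? 7))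
  from10 1 = 5 , extend (staircase 3) (from-yes (3 <? 5)) (from-yes (5 ≤? 7))
  from10 2 = 6 , extend (staircase 3) (from-yes (3 <? 6)) (from-yes (6 ≤? 7))
  from10 3 = 7 , extend (staircase 3) (from-yes (3 <? 7)) (from-yes (7 ≤? 7))
  -- 14 is not of the form 1 + ⋯ + j + x with j < x ≤ 1 + (1 + ⋯ + j); take 1, 2, 4, 7.
  from10 4 = 7 , extend (extend (extend (extend empty
                   (from-yes (0 <? 1)) (from-yes (1 ≤? 1)))
                   (from-yes (1 <? 2)) (from-yes (2 ≤? 2)))
                   (from-yes (2 <? 4)) (from-yes (4 ≤? 4)))
                   (from-yes (4 <? 7)) (from-yes (7 ≤? 8))
  from10 (suc (suc (suc (suc (suc m))))) = staircaseSum⇒complete (staircaseSum-15+ m)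

module Construction {s ℓ d : ℕ} (C : CompleteSequence s ℓ)
                    (d-lower : suc s + 2 ≤ d) (d-upper : d ≤ 2 * suc s + 1) where
  open CompleteSequence C

  e : ℕ
  e = suc (suc s)

  upper : ℕ → ℕ
  upper = prepend 1 (λ _ → e) (multiples d)

  a : ℕ → ℕ
  a = prepend size term upper

  e<d : e < d
  e<d = subst (_≤ d) (+-comm (suc s) 2) d-lower

  1+s<d : suc s < d
  1+s<d = <-trans (n<1+n (suc s)) e<d

  0<d : 0 < d
  0<d = <-trans z<s e<d

  instance
    d≢0 : NonZero d
    d≢0 = >-nonZero 0<d

  multiples-increasing : ∀ j → multiples d j < multiples d (suc j)
  multiples-increasing j = m<n+m (multiples d j) 0<d

  upper-increasing : ∀ j → upper j < upper (suc j)
  upper-increasing = prepend-increasing {1} {λ _ → e}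
    (λ { _ (s≤s ()) }) (λ _ _ → ≤-trans e<d (m≤m+n d 0)) multiples-increasing

  a-increasing : StrictlyIncreasing a
  a-increasing i = subst (λ j → a i < a j) (+-comm 1 i)
    (prepend-increasing {size} {term} increasing
      (λ i i<size → s≤s (m≤n⇒m≤1+n (term≤total i i<size))) upper-increasing i)

  a-positive : ∀ i → 0 < a i
  a-positive = prepend-positive {size} {term} positive
    (prepend-positive {1} {λ _ → e} (λ _ _ → z<s) (λ j → ≤-trans 0<d (m≤m+n d (j * d))))

  InP-a⁺ : ∀ {r x y} → r ≤ s → InPFirst 1 (λ _ → e) x → d ∣ y → InP a (r + (x + y))
  InP-a⁺ r≤s x∈ d∣y =
    InP-prepend⁺ (Complete⇒InPFirst size complete (subst (_ ≤_) (sym total) r≤s))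
                 (InP-prepend⁺ x∈ (InP-multiples⁺ d∣y))

  InP-a⁻ : ∀ {n} → InP a n → ∃₂ λ r y → r ≤ s × d ∣ y × (n ≡ r + y ⊎ n ≡ r + (e + y))
  InP-a⁻ n∈ with InP-prepend⁻ {size} {term} {upper} n∈
  ... | r , z , r∈ , z∈ , refl with InP-prepend⁻ {1} {λ _ → e} {multiples d} z∈
  ...   | x , y , x∈ , y∈ , refl =
    r , y , r≤s , InP-multiples⁻ y∈ , Sum.map (cong plus) (cong plus) (InPFirst-one⁻ x∈)
    where
    r≤s : r ≤ s
    r≤s = subst (r ≤_) total (InPFirst⇒≤partialSum size r∈)
    plus : ℕ → ℕ
    plus z = r + (z + y)

  InP-a⇒∉B : ∀ {n} → InP a n → ¬ InB (suc s) d n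
  InP-a⇒∉B n∈ (K , refl) with InP-a⁻ n∈
  ... | r , y , r≤s , d∣y , inj₁ eq = <⇒≱ (s≤s r≤s) (≤-reflexive residues-agree)
    where
    open ≡-Reasoning
    residues-agree : suc s ≡ r
    residues-agree = begin
      suc s                ≡⟨ sym (m<n⇒m%n≡m 1+s<d) ⟩
      suc s % d            ≡⟨ sym ([m+kn]%n≡m%n (suc s) K d) ⟩
      (suc s + K * d) % d  ≡⟨ cong (_% d) eq ⟩
      (r + y) % d          ≡⟨ %-remove-+ʳ r d∣y ⟩
      r % d                ≡⟨ m<n⇒m%n≡m (≤-<-trans (m≤n⇒m≤1+n r≤s) 1+s<d) ⟩
      r                    ∎
  ... | r , y , r≤s , d∣y , inj₂ eq = <⇒≱ (≤-<-trans (s≤s r≤s) 1+s<d) (∣⇒≤ d∣1+r)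
    where
    rearrange : ∀ r s y → r + (suc (suc s) + y) ≡ suc s + (y + suc r)
    rearrange = solve-∀
    d∣1+r : d ∣ suc r
    d∣1+r = ∣m+n∣m⇒∣n (divides K (sym (+-cancelˡ-≡ (suc s) _ _ (trans eq (rearrange r s y))))) d∣y

  representable : ∀ R Q → R < d → R ≢ suc s → InP a (R + Q * d)
  representable R Q R<d R≢1+s with R ≤? s
  ... | yes R≤s = InP-a⁺ R≤s ([] , [] , [] , refl) (n∣m*n Q)
  ... | no R≰s = subst (InP a) sum≡ (InP-a⁺ r≤s e∈ (n∣m*n Q))
    where
    e≤R : e ≤ R
    e≤R = ≤∧≢⇒< (≰⇒> R≰s) (R≢1+s ∘ sym)
    bound : ∀ s → 2 * suc s + 1 ≡ suc (suc (suc s) + s)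
    bound = solve-∀
    r≤s : R ∸ e ≤ s
    r≤s = m≤n+o⇒m∸n≤o R e (≤-pred (≤-trans R<d (≤-trans d-upper (≤-reflexive (bound s)))))
    e∈ : InPFirst 1 (λ _ → e) e
    e∈ = 0 ∷ [] , [] ∷ [] , z<s ∷ [] , +-identityʳ e
    sum≡ : R ∸ e + (e + Q * d) ≡ R + Q * d
    sum≡ = trans (sym (+-assoc (R ∸ e) e (Q * d))) (cong (_+ Q * d) (m∸n+n≡m e≤R))

  ∉B⇒InP-a : ∀ {n} → ¬ InB (suc s) d n → InP a n
  ∉B⇒InP-a {n} n∉B = subst (InP a) (sym n≡) (representable (n % d) (n / d) (m%n<n n d) R≢1+s)
    where
    n≡ : n ≡ n % d + n / d * d
    n≡ = m≡m%n+[m/n]*n n d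
    R≢1+s : n % d ≢ suc s
    R≢1+s R≡1+s = n∉B (n / d , trans n≡ (cong (_+ n / d * d) R≡1+s))

  subsetSums : Σ (ℕ → ℕ) λ a →
    StrictlyIncreasing a × (∀ i → 0 < a i) × (∀ n → InP a n ⇔ (¬ InB (suc s) d n))
  subsetSums = a , a-increasing , a-positive , λ n → mk⇔ InP-a⇒∉B ∉B⇒InP-a

theorem1p3 : (b₁ d : ℕ) →
    (b₁ ≡ 4 ⊎ b₁ ≡ 7 ⊎ b₁ ≡ 8 ⊎ 11 ≤ b₁) →
    b₁ + 2 ≤ d → d ≤ 2 * b₁ + 1 →
    Σ (ℕ → ℕ) λ a →
      StrictlyIncreasing a × (∀ i → 0 < a i) ×
      (∀ n → InP a n ⇔ (¬ InB b₁ d n))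
theorem1p3 b₁ d b₁-admissible d-lower d-upper with completeSequence b₁-admissible
... | s , refl , ℓ , C = Construction.subsetSums C d-lower d-upper
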